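{- Let $H$ be a finite digraph possibly with loops, $D$ a finite $H$-colored digraph without loops and without isolated vertices, and $\xi=\{C_1,\dots,C_k\}$ ($k\ge2$) a partition of $V(H)$ such that for every $i$ the set $A_i=\{a\in A(D):c(a)\in C_i\}$ is nonempty and $G_i=D[A_i]$ is transitive by $H$-paths. Let $\{\xi_1,\xi_2\}$ be a partition of $\xi$ and, for $i\in\{1,2\}$, let $D_i$ be the spanning subdigraph of $D$ with $A(D_i)=\{a\in A(D):c(a)\in C_j\text{ for some }C_j\in\xi_i\}$. Suppose that (1) for every $i\in\{1,2\}$ and every cycle $\gamma$ contained in $D_i$ there exists $C_m\in\xi_i$ such that $\gamma$ is contained in $G_m$, and (2) for every $i\in\{1,2\}$ and every $H$-walk $P$ contained in $D_i$ there exists $C_{m'}\in\xi_i$ such that $P$ is contained in $G_{m'}$. Then there exists $x_0\in V(D)$ such that $\{x_0\}$ is an $H$-semikernel modulo $D_2$ of $D$.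
   Context: Paths, walks and cycles are directed; a path has pairwise distinct vertices. $D$ is $H$-colored if it has an arc coloring $c:A(D)\to V(H)$. A walk $(v_0,\dots,v_n)$ is an $H$-walk if $(c(v_0,v_1),\dots,c(v_{n-1},v_n))$ is a walk in $H$ (a single arc is an $H$-walk); an $H$-path is a path that is an $H$-walk. $D[A]$ for an arc set $A$ is the subdigraph with arc set $A$ and vertex set the ends of arcs in $A$. A subdigraph $G$ is transitive by $H$-paths if an $xy$-$H$-path contained in $G$ and a $yz$-$H$-path contained in $G$ imply an $xz$-$H$-path contained in $G$. A set $S\subseteq V(D)$ is an $H$-semikernel modulo $D_2$ of $D$ if (i) there is no $H$-path in $D$ between two distinct vertices of $S$, and (ii) for every $z\in V(D)\setminus S$, if there is an $H$-path contained in $D_1$ from a vertex of $S$ to $z$, then there is an $H$-path in $D$ from $z$ to a vertex of $S$. -}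

module Defs where

open import Data.Nat using (ℕ)
open import Data.Fin using (Fin)
open import Data.Bool using (Bool; T)
open import Data.List using (List; []; _∷_; map)
open import Data.List.Relation.Unary.All using (All)
open import Data.List.Relation.Unary.Unique.Propositional using (Unique)
open import Data.Product using (Σ; _×_)
open import Data.Unit using (⊤)
open import Relation.Binary.PropositionalEquality using (_≡_; _≢_)
open import Relation.Nullary using (¬_)

-- A finite digraph: vertices Fin nV, arcs Fin nA, each arc has a tail and a head.
-- (Simplicity, i.e. no parallel arcs, and looplessness are imposed as
--  hypotheses in the theorem.)
record Digraph : Set where
  field
    nV nA : ℕ
    tl hd : Fin nA → Fin nV
open Digraph public

module _ (D : Digraph) {h : ℕ} (H : Fin h → Fin h → Bool)
         (c : Fin (nA D) → Fin h) where

  -- Nonempty arc sequences (a ∷ as).  Head of the last arc: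
  lastHd : Fin (nA D) → List (Fin (nA D)) → Fin (nV D)
  lastHd a []       = hd D a
  lastHd a (b ∷ bs) = lastHd b bs

  verts : Fin (nA D) → List (Fin (nA D)) → List (Fin (nV D))
  verts a as = tl D a ∷ hd D a ∷ map (hd D) as

  Chain : Fin (nA D) → List (Fin (nA D)) → Set
  Chain a []       = ⊤
  Chain a (b ∷ bs) = (hd D a ≡ tl D b) × Chain b bs

  HChain : Fin (nA D) → List (Fin (nA D)) → Set
  HChain a []       = ⊤
  HChain a (b ∷ bs) = (hd D a ≡ tl D b) × T (H (c a) (c b)) × HChain b bs

  AllIn : (Fin (nA D) → Set) → Fin (nA D) → List (Fin (nA D)) → Set
  AllIn P a as = P a × All P as

  IsHWalkIn : (Fin (nA D) → Set) → Fin (nA D) → List (Fin (nA D)) → Set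
  IsHWalkIn P a as = HChain a as × AllIn P a as

  HPathIn : (Fin (nA D) → Set) → Fin (nV D) → Fin (nV D) → Set
  HPathIn P u v = Σ (Fin (nA D)) λ a → Σ (List (Fin (nA D))) λ as →
    (tl D a ≡ u) × (lastHd a as ≡ v) × HChain a as × Unique (verts a as) × AllIn P a as

  HPath : Fin (nV D) → Fin (nV D) → Set
  HPath = HPathIn (λ _ → ⊤)

  IsCycle : Fin (nA D) → List (Fin (nA D)) → Set
  IsCycle a as = Chain a as × (lastHd a as ≡ tl D a) × Unique (tl D a ∷ map (tl D) as)

  TransitiveByHPaths : (Fin (nA D) → Set) → Set
  TransitiveByHPaths P = ∀ x y z → x ≢ z → HPathIn P x y → HPathIn P y z → HPathIn P x z

  -- S is an H-semikernel modulo D₂ of D, where D₁ has arc set P₁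
  IsHSemikernelMod : (Fin (nA D) → Set) → (Fin (nV D) → Set) → Set
  IsHSemikernelMod P₁ S =
    (∀ u v → S u → S v → u ≢ v → ¬ HPath u v) ×
    (∀ z → ¬ S z → Σ (Fin (nV D)) (λ s → S s × HPathIn P₁ s z) →
       Σ (Fin (nV D)) (λ s → S s × HPath z s))

-- Let x₀ be maximal for reachability in D₁, a decidable preorder on a finite set.  An H-path in D₁
-- from x₀ to z lies, by (2), in a single G_m, and by maximality a D₁-walk leads back from z to x₀.
-- Every arc f of the forward walk closes up with a D₁-walk into a cycle through f, which by (1) lies
-- in G_m; so the way back can be rerouted inside G_m, and as G_m is transitive by H-paths this walk
-- yields an H-path from z to x₀.
module Submission where

open import Defs
open import Data.Nat using (ℕ; _≤_)
open import Data.Fin using (Fin; zero; suc)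
open import Data.Bool using (Bool)
open import Data.List using (List)
open import Data.Product using (Σ; _×_; ∃)
open import Data.Sum using (_⊎_)
open import Relation.Binary.PropositionalEquality using (_≡_; _≢_)

open import Data.Empty using (⊥-elim)
open import Data.Fin as Fin using (_≟_)
open import Data.Fin.Induction using (spo-noetherian)
open import Data.Fin.Properties using (any?; pigeonhole)
open import Data.List using ([]; _∷_; map; length; lookup)
open import Data.List.Membership.Propositional using (_∈_)
open import Data.List.Membership.Propositional.Properties using (∈-lookup)
import Data.List.Membership.DecPropositional as DecMembership
open import Data.List.Relation.Unary.All as All using (All; []; _∷_)
open import Data.List.Relation.Unary.All.Properties.Core using (¬Any⇒All¬)
open import Data.List.Relation.Unary.Any using (here; there)
open import Data.List.Relation.Unary.Unique.Propositional using (Unique; []; _∷_)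
open import Data.Nat using (s≤s)
open import Data.Nat.Properties using (≮⇒≥; <⇒≤)
open import Data.Product as Product using (_,_; proj₁; proj₂)
open import Data.Sum using (inj₁; inj₂)
open import Data.Unit using (tt)
open import Function using (flip)
open import Induction.WellFounded using (Acc; acc)
open import Relation.Binary.Core using (Rel)
open import Relation.Binary.Construct.Closure.Reflexive using (ReflClosure; [_]) renaming (refl to ε)
open import Relation.Binary.Definitions using (Decidable; Transitive)
open import Relation.Binary.PropositionalEquality using (refl; sym; trans; cong; subst; subst₂; resp₂; isEquivalence)
open import Relation.Binary.Structures using (IsStrictPartialOrder)
open import Relation.Nullary using (¬_; Dec; yes; no)
open import Relation.Nullary.Decidable using (_×-dec_; _⊎-dec_; ¬?; decidable-stable)

Unique⇒lookup-injective : ∀ {n} {xs : List (Fin n)} → Unique xs →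
  ∀ i j → i Fin.< j → lookup xs i ≢ lookup xs j
Unique⇒lookup-injective (x∉xs ∷ _) zero (suc j) _ = All.lookup x∉xs (∈-lookup j)
Unique⇒lookup-injective (_ ∷ xs-unique) (suc i) (suc j) (s≤s i<j) =
  Unique⇒lookup-injective xs-unique i j i<j

Unique⇒length≤ : ∀ {n} {xs : List (Fin n)} → Unique xs → length xs ≤ n
Unique⇒length≤ {xs = xs} xs-unique = ≮⇒≥ λ n<length →
  let (i , j , i<j , xsᵢ≡xsⱼ) = pigeonhole n<length (lookup xs) in
  Unique⇒lookup-injective xs-unique i j i<j xsᵢ≡xsⱼ

module _ {n r} {R : Rel (Fin n) r} (R? : Decidable R) (R-trans : Transitive R) where

  private
    _⊏_ : Rel (Fin n) r
    x ⊏ y = R x y × ¬ R y x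

    ⊏-isStrictPartialOrder : IsStrictPartialOrder _≡_ _⊏_
    ⊏-isStrictPartialOrder = record
      { isEquivalence = isEquivalence
      ; irrefl        = λ { refl (Rxx , ¬Rxx) → ¬Rxx Rxx }
      ; trans         = λ (Rxy , _) (Ryz , ¬Rzy) → R-trans Rxy Ryz , λ Rzx → ¬Rzy (R-trans Rzx Rxy)
      ; <-resp-≈      = resp₂ _⊏_
      }

    climb : ∀ x → Acc (flip _⊏_) x → Σ (Fin n) λ x₀ → ∀ z → R x₀ z → R z x₀
    climb x (acc above) with any? (λ z → R? x z ×-dec ¬? (R? z x))
    ... | yes (z , x⊏z) = climb z (above x⊏z)
    ... | no ∄z         = x , λ z Rxz → decidable-stable (R? z x) λ ¬Rzx → ∄z (z , Rxz , ¬Rzx)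

  ∃-maximal : Fin n → Σ (Fin n) λ x₀ → ∀ z → R x₀ z → R z x₀
  ∃-maximal x = climb x (spo-noetherian ⊏-isStrictPartialOrder x)

module Walks (D : Digraph) where

  infixr 5 _∷⟨_⟩_

  data Walk (P : Fin (nA D) → Set) : Fin (nV D) → Fin (nV D) → Set where
    []     : ∀ {u} → Walk P u u
    _∷⟨_⟩_ : ∀ {v} a → P a → Walk P (hd D a) v → Walk P (tl D a) v

  module _ {P : Fin (nA D) → Set} where

    arcs : ∀ {u v} → Walk P u v → List (Fin (nA D))
    arcs []           = []
    arcs (a ∷⟨ _ ⟩ w) = a ∷ arcs w

    vertices : ∀ {u v} → Walk P u v → List (Fin (nV D))
    vertices ([] {u})     = u ∷ []
    vertices (a ∷⟨ _ ⟩ w) = tl D a ∷ vertices w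

    walkLength : ∀ {u v} → Walk P u v → ℕ
    walkLength []           = 0
    walkLength (_ ∷⟨ _ ⟩ w) = ℕ.suc (walkLength w)

    length-vertices : ∀ {u v} (w : Walk P u v) → length (vertices w) ≡ ℕ.suc (walkLength w)
    length-vertices []           = refl
    length-vertices (_ ∷⟨ _ ⟩ w) = cong ℕ.suc (length-vertices w)

    infixr 5 _++_
    _++_ : ∀ {u v x} → Walk P u v → Walk P v x → Walk P u x
    []           ++ w′ = w′
    (a ∷⟨ p ⟩ w) ++ w′ = a ∷⟨ p ⟩ (w ++ w′)

    arcs-All : ∀ {u v} (w : Walk P u v) → All P (arcs w)
    arcs-All []           = []
    arcs-All (_ ∷⟨ p ⟩ w) = p ∷ arcs-All w

    restrict : ∀ {Q u v} (w : Walk P u v) → All Q (arcs w) → Walk Q u v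
    restrict []           _        = []
    restrict (a ∷⟨ _ ⟩ w) (q ∷ qs) = a ∷⟨ q ⟩ restrict w qs

    Path : Fin (nV D) → Fin (nV D) → Set
    Path u v = Σ (Walk P u v) λ w → Unique (vertices w)

    suffixFrom : ∀ {u v x} (w : Walk P u v) → Unique (vertices w) → x ∈ vertices w → Path x v
    suffixFrom []           w-unique     (here refl) = [] , w-unique
    suffixFrom (a ∷⟨ p ⟩ w) w-unique     (here refl) = a ∷⟨ p ⟩ w , w-unique
    suffixFrom (_ ∷⟨ _ ⟩ w) (_ ∷ unique) (there x∈w) = suffixFrom w unique x∈w

    shorten : ∀ {u v} → Walk P u v → Path u v
    shorten []           = [] , ([] ∷ [])
    shorten (a ∷⟨ p ⟩ w) with shorten w
    ... | w′ , w′-unique with DecMembership._∈?_ _≟_ (tl D a) (vertices w′)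
    ... | yes tl∈w′ = suffixFrom w′ w′-unique tl∈w′
    ... | no  tl∉w′ = a ∷⟨ p ⟩ w′ , ¬Any⇒All¬ _ tl∉w′ ∷ w′-unique

    end∈vertices : ∀ {u v} (w : Walk P u v) → v ∈ vertices w
    end∈vertices []           = here refl
    end∈vertices (_ ∷⟨ _ ⟩ w) = there (end∈vertices w)

    tails⊆vertices : ∀ {u v x} (w : Walk P u v) → x ∈ map (tl D) (arcs w) → x ∈ vertices w
    tails⊆vertices (_ ∷⟨ _ ⟩ w) (here x≡tl)  = here x≡tl
    tails⊆vertices (_ ∷⟨ _ ⟩ w) (there x∈w) = there (tails⊆vertices w x∈w)

    Unique-end∷tails : ∀ {u v} (w : Walk P u v) → Unique (vertices w) → Unique (v ∷ map (tl D) (arcs w))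
    Unique-end∷tails []           _                  = [] ∷ []
    Unique-end∷tails (a ∷⟨ _ ⟩ w) (tl∉w ∷ w-unique) with Unique-end∷tails w w-unique
    ... | v∉tails ∷ tails-unique =
      ((λ v≡tl → All.lookup tl∉w (end∈vertices w) (sym v≡tl)) ∷ v∉tails)
      ∷ All.tabulate (λ x∈tails → All.lookup tl∉w (tails⊆vertices w x∈tails)) ∷ tails-unique

  weaken : ∀ {P Q : Fin (nA D) → Set} → (∀ {a} → P a → Q a) → ∀ {u v} → Walk P u v → Walk Q u v
  weaken P⇒Q []           = []
  weaken P⇒Q (a ∷⟨ p ⟩ w) = a ∷⟨ P⇒Q p ⟩ weaken P⇒Q w

module Reachability (D : Digraph) {P : Fin (nA D) → Set} (P? : ∀ a → Dec (P a)) where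

  open Walks D

  ReachableIn : ℕ → Fin (nV D) → Fin (nV D) → Set
  ReachableIn ℕ.zero    u v = u ≡ v
  ReachableIn (ℕ.suc n) u v = u ≡ v ⊎ ∃ λ a → P a × tl D a ≡ u × ReachableIn n (hd D a) v

  reachableIn? : ∀ n → Decidable (ReachableIn n)
  reachableIn? ℕ.zero    u v = u ≟ v
  reachableIn? (ℕ.suc n) u v = (u ≟ v) ⊎-dec any? λ a → P? a ×-dec (tl D a ≟ u) ×-dec reachableIn? n (hd D a) v

  ReachableIn⇒Walk : ∀ n {u v} → ReachableIn n u v → Walk P u v
  ReachableIn⇒Walk ℕ.zero    refl                        = []
  ReachableIn⇒Walk (ℕ.suc n) (inj₁ refl)                 = []
  ReachableIn⇒Walk (ℕ.suc n) (inj₂ (a , p , refl , rest)) = a ∷⟨ p ⟩ ReachableIn⇒Walk n rest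

  Walk⇒ReachableIn : ∀ n {u v} (w : Walk P u v) → walkLength w ≤ n → ReachableIn n u v
  Walk⇒ReachableIn ℕ.zero    []           _         = refl
  Walk⇒ReachableIn (ℕ.suc n) []           _         = inj₁ refl
  Walk⇒ReachableIn (ℕ.suc n) (a ∷⟨ p ⟩ w) (s≤s w≤n) = inj₂ (a , p , refl , Walk⇒ReachableIn n w w≤n)

  Reachable : Fin (nV D) → Fin (nV D) → Set
  Reachable = ReachableIn (nV D)

  reachable? : Decidable Reachable
  reachable? = reachableIn? (nV D)

  Reachable⇒Walk : ∀ {u v} → Reachable u v → Walk P u v
  Reachable⇒Walk = ReachableIn⇒Walk (nV D)

  Walk⇒Reachable : ∀ {u v} → Walk P u v → Reachable u v
  Walk⇒Reachable w with shorten w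
  ... | path , path-unique = Walk⇒ReachableIn (nV D) path
    (<⇒≤ (subst (_≤ nV D) (length-vertices path) (Unique⇒length≤ path-unique)))

  reachable-trans : Transitive Reachable
  reachable-trans r r′ = Walk⇒Reachable (Reachable⇒Walk r ++ Reachable⇒Walk r′)

module HPaths (D : Digraph) {h : ℕ} (H : Fin h → Fin h → Bool) (c : Fin (nA D) → Fin h) where

  open Walks D

  HChain⇒Walk : ∀ {P} a as → HChain D H c a as → AllIn D H c P a as → Walk P (tl D a) (lastHd D H c a as)
  HChain⇒Walk a []       _                    (p , [])       = a ∷⟨ p ⟩ []
  HChain⇒Walk a (b ∷ bs) (hd≡tl , _ , chain) (p , pb ∷ ps) =
    a ∷⟨ p ⟩ subst (λ x → Walk _ x (lastHd D H c b bs)) (sym hd≡tl) (HChain⇒Walk b bs chain (pb , ps))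

  HPathIn⇒HPath : ∀ {Q u v} → HPathIn D H c Q u v → HPath D H c u v
  HPathIn⇒HPath (a , as , tl≡u , last≡v , chain , unique , _ , inQ) =
    a , as , tl≡u , last≡v , chain , unique , tt , All.map (λ _ → tt) inQ

  Walk⇒Chain : ∀ {P u v} a → hd D a ≡ u → (w : Walk P u v) →
    Chain D H c a (arcs w) × lastHd D H c a (arcs w) ≡ v
  Walk⇒Chain a hd≡u []           = tt , hd≡u
  Walk⇒Chain a hd≡u (b ∷⟨ _ ⟩ w) = Product.map₁ (hd≡u ,_) (Walk⇒Chain b refl w)

  Path⇒Cycle : ∀ {P} f (w : Walk P (hd D f) (tl D f)) → Unique (vertices w) → IsCycle D H c f (arcs w)
  Path⇒Cycle f w w-unique =
    let chain , closed = Walk⇒Chain f refl w in chain , closed , Unique-end∷tails w w-unique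

  module _ (loopless : ∀ a → tl D a ≢ hd D a) {Q : Fin (nA D) → Set}
           (Q-trans : TransitiveByHPaths D H c Q) where

    arc-HPathIn : ∀ a → Q a → HPathIn D H c Q (tl D a) (hd D a)
    arc-HPathIn a q = a , [] , refl , refl , tt , (loopless a ∷ []) ∷ [] ∷ [] , q , []

    -- Transitivity needs distinct ends, so the path built so far is dropped whenever the walk revisits u.
    Walk⇒HPathIn : ∀ {u x v} → ReflClosure (HPathIn D H c Q) u x → Walk Q x v → u ≢ v → HPathIn D H c Q u v
    Walk⇒HPathIn ε       []  u≢v = ⊥-elim (u≢v refl)
    Walk⇒HPathIn [ u↝x ] []  _   = u↝x
    Walk⇒HPathIn {u} u↝tl (a ∷⟨ q ⟩ w) u≢v with u ≟ hd D a
    ... | yes refl  = Walk⇒HPathIn ε w u≢v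
    ... | no  u≢hd  = Walk⇒HPathIn [ extend u↝tl ] w u≢v
      where
      extend : ReflClosure (HPathIn D H c Q) u (tl D a) → HPathIn D H c Q u (hd D a)
      extend ε         = arc-HPathIn a q
      extend [ u↝tl′ ] = Q-trans u (tl D a) (hd D a) u≢hd u↝tl′ (arc-HPathIn a q)

module Monochromatic (D : Digraph) {h : ℕ} (H : Fin h → Fin h → Bool) (c : Fin (nA D) → Fin h)
  {P : Fin (nA D) → Set} {K : Set} (κ : Fin (nA D) → K)
  (cycles-monochromatic : ∀ a as → IsCycle D H c a as → AllIn D H c P a as →
     ∃ λ m → AllIn D H c (λ b → κ b ≡ m) a as)
  {m : K} (colour⊆P : ∀ {b} → κ b ≡ m → P b) where

  open Walks D
  open HPaths D H c

  Colour : Fin (nA D) → Set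
  Colour b = κ b ≡ m

  -- f followed by the P-walk back is closed; shortened, it is a cycle through f, hence of f's colour.
  return-in-colour : ∀ f → Colour f → Walk P (hd D f) (tl D f) → Walk Colour (hd D f) (tl D f)
  return-in-colour f κf≡m w with shorten w
  ... | path , path-unique with cycles-monochromatic f (arcs path) (Path⇒Cycle f path path-unique)
                                                    (colour⊆P κf≡m , arcs-All path)
  ... | _ , κf≡m′ , path-m′ = restrict path (All.map (λ κb≡m′ → trans κb≡m′ (trans (sym κf≡m′) κf≡m)) path-m′)

  reverse-in-colour : ∀ {s t} → Walk Colour s t → Walk P t s → Walk Colour t s
  reverse-in-colour []           _    = []
  reverse-in-colour (f ∷⟨ κf ⟩ w) back =
    reverse-in-colour w (back ++ f ∷⟨ colour⊆P κf ⟩ []) ++ return-in-colour f κf (weaken colour⊆P w ++ back)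

mainTheorem7 :
  (D : Digraph) {h : ℕ} (H : Fin h → Fin h → Bool) (c : Fin (nA D) → Fin h)
  (k : ℕ) (cls : Fin h → Fin k) (side : Fin k → Fin 2) →
  -- D has no loops, no parallel arcs, no isolated vertices
  (∀ a → tl D a ≢ hd D a) →
  (∀ a b → tl D a ≡ tl D b → hd D a ≡ hd D b → a ≡ b) →
  (∀ v → ∃ λ a → (tl D a ≡ v) ⊎ (hd D a ≡ v)) →
  -- ξ = {C_1..C_k}, k ≥ 2, each A_j nonempty, each G_j transitive by H-paths
  2 ≤ k →
  (∀ j → ∃ λ a → cls (c a) ≡ j) →
  (∀ j → TransitiveByHPaths D H c (λ a → cls (c a) ≡ j)) →
  -- {ξ_1, ξ_2} is a partition of ξ (both parts nonempty)
  (∀ i → ∃ λ j → side j ≡ i) →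
  -- (1) cycles in D_i lie in some G_m with C_m ∈ ξ_i
  (∀ i a as → IsCycle D H c a as → AllIn D H c (λ b → side (cls (c b)) ≡ i) a as →
     ∃ λ m → side m ≡ i × AllIn D H c (λ b → cls (c b) ≡ m) a as) →
  -- (2) H-walks in D_i lie in some G_m' with C_m' ∈ ξ_i
  (∀ i a as → IsHWalkIn D H c (λ b → side (cls (c b)) ≡ i) a as →
     ∃ λ m → side m ≡ i × AllIn D H c (λ b → cls (c b) ≡ m) a as) →
  Σ (Fin (nV D)) λ x₀ →
    IsHSemikernelMod D H c (λ b → side (cls (c b)) ≡ zero) (λ v → v ≡ x₀)
mainTheorem7 D H c k cls side loopless _ _ _ nonempty classes-transitive sides cycles-in-class walks-in-class =
  x₀ , (λ u v u≡x₀ v≡x₀ u≢v _ → u≢v (trans u≡x₀ (sym v≡x₀))) , return-to-x₀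
  where
  open Walks D
  open HPaths D H c
  open Reachability D (λ b → side (cls (c b)) ≟ zero)

  D₁ : Fin (nA D) → Set
  D₁ b = side (cls (c b)) ≡ zero

  x₀-maximal : Σ (Fin (nV D)) λ x₀ → ∀ z → Reachable x₀ z → Reachable z x₀
  x₀-maximal = ∃-maximal reachable? reachable-trans (tl D (proj₁ (nonempty (proj₁ (sides zero)))))
  x₀ : Fin (nV D)
  x₀ = proj₁ x₀-maximal

  return-to-x₀ : ∀ z → z ≢ x₀ → Σ (Fin (nV D)) (λ s → s ≡ x₀ × HPathIn D H c D₁ s z) →
    Σ (Fin (nV D)) (λ s → s ≡ x₀ × HPath D H c z s)
  return-to-x₀ z z≢x₀ (s , s≡x₀ , a , as , tl≡s , last≡z , chain , _ , inD₁)
    with walks-in-class zero a as (chain , inD₁)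
  ... | m , side-m , inClass = x₀ , refl ,
      HPathIn⇒HPath (Walk⇒HPathIn loopless (classes-transitive m) ε (reverse-in-colour x₀↝z z↝x₀) z≢x₀)
    where
    class⊆D₁ : ∀ {b} → cls (c b) ≡ m → D₁ b
    class⊆D₁ refl = side-m
    open Monochromatic D H c (λ b → cls (c b))
      (λ b bs cycle inside → Product.map₂ proj₂ (cycles-in-class zero b bs cycle inside)) class⊆D₁
    x₀↝z : Walk Colour x₀ z
    x₀↝z = subst₂ (Walk Colour) (trans tl≡s s≡x₀) last≡z (HChain⇒Walk a as chain inClass)
    z↝x₀ : Walk D₁ z x₀
    z↝x₀ = Reachable⇒Walk (proj₂ x₀-maximal z (Walk⇒Reachable (weaken class⊆D₁ x₀↝z)))
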